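{- For every $n\ge1$, the matrix $Q_{2n}$ has columns (from left to right) $\alpha_{2n,1},\alpha_{2n,3},\dots,\alpha_{2n,2n-1},-\alpha_{2n,0},-\alpha_{2n,2},\dots,-\alpha_{2n,2n-2}$, and the matrix $Q_{2n+1}$ has columns $\alpha_{2n+1,1},\alpha_{2n+1,3},\dots,\alpha_{2n+1,2n-1},-\mathbf 1_{2n+1},-\alpha_{2n+1,1},-\alpha_{2n+1,3},\dots,-\alpha_{2n+1,2n-1}$.
   Context: For $N\ge1$, $Q_N=\left[\mathrm{sgn}\left(\sin\left(\frac{i+2j}{N+1}\pi\right)\right)\right]_{1\le i,j\le N}$, with $\mathrm{sgn}$ the sign function. For $0\le i\le N-1$, $\alpha_{N,i}$ is the column vector of dimension $N$ whose $(N-i)$-th entry is $0$, all entries above it are $1$ and all entries below it are $-1$. $\mathbf 1_N$ is the $N$-dimensional column vector of all ones. -}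

module Defs where

open import Data.Nat using (ℕ; zero; suc; _+_; _*_; _∸_; _<ᵇ_; _≡ᵇ_)
open import Data.Nat.DivMod using (_%_)
open import Data.Bool using (if_then_else_)
open import Data.Integer using (ℤ; +_; -_; -[1+_])
open import Data.Fin using (Fin; toℕ)

-- sgn (sin (k π / M)) for M = suc m ≥ 1, computed exactly:
-- with r = k mod 2M, sin(kπ/M) is 0 iff r ∈ {0, M}, positive iff 0 < r < M,
-- negative iff M < r < 2M.
sgnSinPiOver : (m : ℕ) → ℕ → ℤ
sgnSinPiOver m k =
  let M = suc m
      r = k % (M + M)
  in if r ≡ᵇ 0 then + 0
     else if r ≡ᵇ M then + 0
     else if r <ᵇ M then + 1
     else -[1+ 0 ]

-- Q_N as a function of (row, column), with 0-based Fin indices;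
-- the paper's 1-based indices are i = toℕ r + 1, j = toℕ c + 1.
-- Entry: sgn (sin ((i + 2j) π / (N + 1))).
Q : (N : ℕ) → Fin N → Fin N → ℤ
Q N r c = sgnSinPiOver N ((suc (toℕ r)) + 2 * suc (toℕ c))

-- α_{N,i}: column vector of dimension N whose (N-i)-th entry (1-based) is 0,
-- entries above it are 1 and entries below are -1.
α : (N : ℕ) → ℕ → Fin N → ℤ
α N i r =
  let p = suc (toℕ r)
      z = N ∸ i
  in if p <ᵇ z then + 1
     else if p ≡ᵇ z then + 0
     else -[1+ 0 ]

𝟏 : (N : ℕ) → Fin N → ℤ
𝟏 N _ = + 1

col : {N : ℕ} → (Fin N → Fin N → ℤ) → Fin N → (Fin N → ℤ)
col A c r = A r c

{-# OPTIONS --safe #-}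
module Submission where

-- Entry (i, j) of Q_N (1-based) is the sign of sin ((i + 2j) π / M) with M = N + 1.
-- If 2j ≤ M, write 2j = M - z: as sin (π - θ) = sin θ, the entry is the sign of
-- sin ((z - i) π / M), which is sgn (z - i) because |z - i| < M; this is the i-th entry
-- of α_{N,N-z} = α_{N,2j-1}. If 2j > M, the extra half-turn sin (θ + π) = - sin θ flips
-- the sign, and the same computation gives - α_{N,2j-2-N}. For N = 2n + 1 the middle
-- column is α_{N,N}, which has no zero entry, i.e. it is - 1_N.

open import Data.Bool.Base using (true; false; if_then_else_)
open import Data.Fin.Base using (Fin; toℕ; _↑ˡ_; _↑ʳ_)
open import Data.Fin.Properties using (toℕ-↑ˡ; toℕ-↑ʳ; toℕ<n)
open import Data.Integer.Base using (ℤ; +_; -_; -[1+_])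
open import Data.Integer.Properties using (neg-involutive)
open import Data.List.Base using (_∷_; [])
open import Data.Nat.Base
open import Data.Nat.DivMod using (_%_; _/_; m<n⇒m%n≡m; m%n<n; m%n%n≡m%n; [m+n]%n≡m%n; [m+kn]%n≡m%n; m≡m%n+[m/n]*n)
open import Data.Nat.Properties
open import Data.Nat.Tactic.RingSolver using (solve)
open import Data.Product.Base using (_×_; _,_)
open import Relation.Binary.Definitions using (tri<; tri≈; tri>)
open import Relation.Binary.PropositionalEquality
open import Relation.Nullary.Decidable using (yes; no; dec-true; dec-false)
open import Relation.Nullary.Negation using (¬_)

open import Defs

open ≡-Reasoning

<ᵇ-true : ∀ {m n} → m < n → (m <ᵇ n) ≡ true
<ᵇ-true {m} {n} = dec-true (m <? n)

<ᵇ-false : ∀ {m n} → ¬ m < n → (m <ᵇ n) ≡ false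
<ᵇ-false {m} {n} = dec-false (m <? n)

≡ᵇ-refl : ∀ m → (m ≡ᵇ m) ≡ true
≡ᵇ-refl m = dec-true (m ≟ m) refl

≡ᵇ-false : ∀ {m n} → m ≢ n → (m ≡ᵇ n) ≡ false
≡ᵇ-false {m} {n} = dec-false (m ≟ n)

-- The sign of sin (r π / M) for r < 2M: sgnSinPiOver m x unfolds to
-- sinSign (suc m) (x % (suc m + suc m)).
sinSign : ℕ → ℕ → ℤ
sinSign M r = if r ≡ᵇ 0 then + 0 else if r ≡ᵇ M then + 0 else if r <ᵇ M then + 1 else -[1+ 0 ]

-- The sign of z - p: α N i r unfolds to sgnDiff (N ∸ i) (suc (toℕ r)).
sgnDiff : ℕ → ℕ → ℤ
sgnDiff z p = if p <ᵇ z then + 1 else if p ≡ᵇ z then + 0 else -[1+ 0 ]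

sgnDiff-< : ∀ {z p} → p < z → sgnDiff z p ≡ + 1
sgnDiff-< p<z rewrite <ᵇ-true p<z = refl

sgnDiff-+ˡ : ∀ d {z p} → sgnDiff (d + z) (d + p) ≡ sgnDiff z p
sgnDiff-+ˡ zero    = refl
sgnDiff-+ˡ (suc d) = sgnDiff-+ˡ d

sinSign-sgnDiff : ∀ M {r} → 0 < r → sinSign M r ≡ sgnDiff M r
sinSign-sgnDiff M {suc r} _ with <-cmp (suc r) M
... | tri< r<M r≢M _ rewrite ≡ᵇ-false r≢M | <ᵇ-true r<M = refl
... | tri≈ _ refl _ rewrite ≡ᵇ-refl r | <ᵇ-false (<-irrefl {suc r} refl) = refl
... | tri> r≮M r≢M _ rewrite ≡ᵇ-false r≢M | <ᵇ-false r≮M = refl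

sinSign-self : ∀ m → sinSign (suc m) (suc m) ≡ + 0
sinSign-self m rewrite ≡ᵇ-refl m = refl

sgnSinPiOver-cong : ∀ m x y → x % (suc m + suc m) ≡ y % (suc m + suc m) →
                    sgnSinPiOver m x ≡ sgnSinPiOver m y
sgnSinPiOver-cong m _ _ = cong (sinSign (suc m))

sgnSinPiOver-< : ∀ m {x} → x < suc m + suc m → sgnSinPiOver m x ≡ sinSign (suc m) x
sgnSinPiOver-< m x<2M = cong (sinSign (suc m)) (m<n⇒m%n≡m x<2M)

sgnSinPiOver-shift : ∀ m d z {p} → d + z ≡ suc m → 0 < p → p < suc m →
                     sgnSinPiOver m (d + p) ≡ sgnDiff z p
sgnSinPiOver-shift m d z {p} d+z≡M 0<p p<M = begin
  sgnSinPiOver m (d + p)   ≡⟨ sgnSinPiOver-< m (+-mono-≤-< d≤M p<M) ⟩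
  sinSign (suc m) (d + p)  ≡⟨ sinSign-sgnDiff (suc m) (<-≤-trans 0<p (m≤n+m p d)) ⟩
  sgnDiff (suc m) (d + p)  ≡⟨ cong (λ t → sgnDiff t (d + p)) d+z≡M ⟨
  sgnDiff (d + z) (d + p)  ≡⟨ sgnDiff-+ˡ d ⟩
  sgnDiff z p              ∎
  where
  d≤M : d ≤ suc m
  d≤M = subst (d ≤_) d+z≡M (m≤m+n d z)

sgnSinPiOver-antiperiodic-< : ∀ m {x} → x < suc m → sgnSinPiOver m (suc m + x) ≡ - sgnSinPiOver m x
sgnSinPiOver-antiperiodic-< m {zero} _ = begin
  sgnSinPiOver m (suc m + 0)   ≡⟨ sgnSinPiOver-< m (+-monoʳ-< (suc m) z<s) ⟩
  sinSign (suc m) (suc m + 0)  ≡⟨ cong (sinSign (suc m)) (+-identityʳ (suc m)) ⟩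
  sinSign (suc m) (suc m)      ≡⟨ sinSign-self m ⟩
  + 0                          ∎
sgnSinPiOver-antiperiodic-< m {x@(suc _)} x<M = begin
  sgnSinPiOver m (suc m + x)   ≡⟨ sgnSinPiOver-shift m (suc m) 0 (+-identityʳ (suc m)) z<s x<M ⟩
  -[1+ 0 ]                     ≡⟨ cong -_ (sgnDiff-< x<M) ⟨
  - sgnDiff (suc m) x          ≡⟨ cong -_ (sgnSinPiOver-shift m 0 (suc m) refl z<s x<M) ⟨
  - sgnSinPiOver m x           ∎

sgnSinPiOver-antiperiodic : ∀ m x → sgnSinPiOver m (suc m + x) ≡ - sgnSinPiOver m x
sgnSinPiOver-antiperiodic m x = begin
  sgnSinPiOver m (M + x)       ≡⟨ sgnSinPiOver-cong m (M + x) (M + x % 2M) (%-reduceʳ M x) ⟩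
  sgnSinPiOver m (M + x % 2M)  ≡⟨ residue (m%n<n x 2M) ⟩
  - sgnSinPiOver m (x % 2M)    ≡⟨ cong -_ (sgnSinPiOver-cong m (x % 2M) x (m%n%n≡m%n x 2M)) ⟩
  - sgnSinPiOver m x           ∎
  where
  M 2M : ℕ
  M  = suc m
  2M = M + M

  %-reduceʳ : ∀ a b → (a + b) % 2M ≡ (a + b % 2M) % 2M
  %-reduceʳ a b = begin
    (a + b) % 2M                       ≡⟨ cong (λ t → (a + t) % 2M) (m≡m%n+[m/n]*n b 2M) ⟩
    (a + (b % 2M + b / 2M * 2M)) % 2M  ≡⟨ cong (_% 2M) (+-assoc a (b % 2M) _) ⟨
    (a + b % 2M + b / 2M * 2M) % 2M    ≡⟨ [m+kn]%n≡m%n (a + b % 2M) (b / 2M) 2M ⟩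
    (a + b % 2M) % 2M                  ∎

  residue : ∀ {r} → r < 2M → sgnSinPiOver m (M + r) ≡ - sgnSinPiOver m r
  residue {r} r<2M with M ≤? r
  ... | no M≰r = sgnSinPiOver-antiperiodic-< m (≰⇒> M≰r)
  ... | yes M≤r with m≤n⇒∃[o]m+o≡n M≤r
  ...   | s , refl = begin
    sgnSinPiOver m (M + (M + s))   ≡⟨ sgnSinPiOver-cong m (M + (M + s)) s full-turn ⟩
    sgnSinPiOver m s               ≡⟨ neg-involutive _ ⟨
    - - sgnSinPiOver m s           ≡⟨ cong -_ (sgnSinPiOver-antiperiodic-< m (+-cancelˡ-< M s M r<2M)) ⟨
    - sgnSinPiOver m (M + s)       ∎
    where
    full-turn : (M + (M + s)) % 2M ≡ s % 2M
    full-turn = trans (cong (_% 2M) (trans (sym (+-assoc M M s)) (+-comm 2M s))) ([m+n]%n≡m%n s 2M)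

α-≥ : ∀ {N i} → N ≤ i → (r : Fin N) → α N i r ≡ - 𝟏 N r
α-≥ N≤i r = cong (λ z → sgnDiff z (suc (toℕ r))) (m≤n⇒m∸n≡0 N≤i)

col-Q≡α : ∀ {N j} (c : Fin N) → toℕ c ≡ j → 2 * j < N →
          (r : Fin N) → col (Q N) c r ≡ α N (suc (2 * j)) r
col-Q≡α {N} {j} c refl 2j<N r = begin
  sgnSinPiOver N (p + 2 * suc j)  ≡⟨ cong (sgnSinPiOver N) (+-comm p (2 * suc j)) ⟩
  sgnSinPiOver N (2 * suc j + p)  ≡⟨ sgnSinPiOver-shift N (2 * suc j) z shift z<s (s≤s (toℕ<n r)) ⟩
  sgnDiff z p                     ∎
  where
  p z : ℕ
  p = suc (toℕ r)
  z = N ∸ suc (2 * j)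

  shift : 2 * suc j + z ≡ suc N
  shift = begin
    2 * suc j + z          ≡⟨ cong (_+ z) (*-suc 2 j) ⟩
    suc (suc (2 * j) + z)  ≡⟨ cong suc (m+[n∸m]≡n 2j<N) ⟩
    suc N                  ∎

col-Q≡-α : ∀ {N i j} (c : Fin N) → toℕ c ≡ j → N + i ≡ 2 * j →
           (r : Fin N) → col (Q N) c r ≡ - α N i r
col-Q≡-α {N} {i} {j} c refl N+i≡2j r = begin
  sgnSinPiOver N (p + 2 * suc j)        ≡⟨ cong (sgnSinPiOver N) (rearrange p) ⟩
  sgnSinPiOver N (suc N + (suc i + p))  ≡⟨ sgnSinPiOver-antiperiodic N (suc i + p) ⟩
  - sgnSinPiOver N (suc i + p)          ≡⟨ cong -_ (sgnSinPiOver-shift N (suc i) (N ∸ i) shift z<s p<1+N) ⟩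
  - sgnDiff (N ∸ i) p                   ∎
  where
  p : ℕ
  p = suc (toℕ r)

  p<1+N : p < suc N
  p<1+N = s≤s (toℕ<n r)

  rearrange : ∀ q → q + 2 * suc j ≡ suc N + (suc i + q)
  rearrange q = begin
    q + 2 * suc j        ≡⟨ cong (λ t → q + t) (*-suc 2 j) ⟩
    q + (2 + 2 * j)      ≡⟨ cong (λ t → q + (2 + t)) N+i≡2j ⟨
    q + (2 + (N + i))    ≡⟨ solve (q ∷ N ∷ i ∷ []) ⟩
    suc N + (suc i + q)  ∎

  i≤N : i ≤ N
  i≤N = +-cancelˡ-≤ N i N (subst₂ _≤_ (sym N+i≡2j) (cong (λ t → N + t) (+-identityʳ N))
                                     (*-monoʳ-≤ 2 (<⇒≤ (toℕ<n c))))

  shift : suc i + (N ∸ i) ≡ suc N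
  shift = cong suc (m+[n∸m]≡n i≤N)

lemma3p6 : (n : ℕ) → 1 ≤ n →
    -- Q_{2n}: columns α_{2n,1}, α_{2n,3}, …, α_{2n,2n-1}, -α_{2n,0}, -α_{2n,2}, …, -α_{2n,2n-2}
    ((k : Fin n) → (r : Fin (n + n)) →
        col (Q (n + n)) (k ↑ˡ n) r ≡ α (n + n) (suc (2 * toℕ k)) r)
    × ((k : Fin n) → (r : Fin (n + n)) →
        col (Q (n + n)) (n ↑ʳ k) r ≡ - α (n + n) (2 * toℕ k) r)
    -- Q_{2n+1}: columns α_{2n+1,1}, …, α_{2n+1,2n-1}, -1_{2n+1}, -α_{2n+1,1}, …, -α_{2n+1,2n-1}
    × ((k : Fin n) → (r : Fin (n + suc n)) →
        col (Q (n + suc n)) (k ↑ˡ suc n) r ≡ α (n + suc n) (suc (2 * toℕ k)) r)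
    × ((r : Fin (n + suc n)) →
        col (Q (n + suc n)) (n ↑ʳ Fin.zero) r ≡ - 𝟏 (n + suc n) r)
    × ((k : Fin n) → (r : Fin (n + suc n)) →
        col (Q (n + suc n)) (n ↑ʳ Fin.suc k) r ≡ - α (n + suc n) (suc (2 * toℕ k)) r)
lemma3p6 n _ =
    (λ k → col-Q≡α (k ↑ˡ n) (toℕ-↑ˡ k n) (2k<2n k))
  , (λ k → col-Q≡-α (n ↑ʳ k) (toℕ-↑ʳ n k) (even-offset (toℕ k)))
  , (λ k → col-Q≡α (k ↑ˡ suc n) (toℕ-↑ˡ k (suc n)) (<-≤-trans (2k<2n k) (+-monoʳ-≤ n (n≤1+n n))))
  , (λ r → trans (col-Q≡α (n ↑ʳ Fin.zero) (trans (toℕ-↑ʳ n Fin.zero) (+-identityʳ n))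
                           (≤-reflexive 1+2n≡2n+1) r)
                 (α-≥ (≤-reflexive (sym 1+2n≡2n+1)) r))
  , (λ k → col-Q≡-α (n ↑ʳ Fin.suc k) (toℕ-↑ʳ n (Fin.suc k)) (odd-offset (toℕ k)))
  where
  2k<2n : (k : Fin n) → 2 * toℕ k < n + n
  2k<2n k = subst (2 * toℕ k <_) (cong (λ t → n + t) (+-identityʳ n)) (*-monoʳ-< 2 (toℕ<n k))

  1+2n≡2n+1 : suc (2 * n) ≡ n + suc n
  1+2n≡2n+1 = solve (n ∷ [])

  even-offset : ∀ k → n + n + 2 * k ≡ 2 * (n + k)
  even-offset k = solve (n ∷ k ∷ [])

  odd-offset : ∀ k → n + suc n + suc (2 * k) ≡ 2 * (n + suc k)
  odd-offset k = solve (n ∷ k ∷ [])
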